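{- Assume $\mathbb{I}$ is countable. For each tuple $\bar A=(A_1,\dots,A_n)$ of finite subsets of $\mathbb{I}$, the generalised power $W(\mathbb{I})^{(\bar A)}$ is definitionally equivalent to the structure $(W(\mathbb{I}),\bar A)$ after identifying their universes via the bijection $g_{\bar A}$. Moreover this equivalence is uniform: the same formulas can be used to establish the equivalence for every tuple $\bar A$ of length $n$.
   Context: $\mathbb{I}$ is a dense linear order with least element $0$ and no greatest element. $\mathcal{L}_{MO}=\{\subseteq,\overset{\exists}{<}\}$ (binary relation symbols). For a linear order $\alpha$, $W(\alpha)$ is the $\mathcal{L}_{MO}$-structure on the finite subsets of $\alpha$ with inclusion and $A\overset{\exists}{<}B$ iff $i<j$ for some $i\in A,j\in B$. $(W(\mathbb{I}),\bar A)$ is $W(\mathbb{I})$ expanded by constants $c_1,\dots,c_n$ naming $A_1,\dots,A_n$. Let $\langle\bar A\rangle=\{0\}\cup A_1\cup\dots\cup A_n$ (a finite set), and let $W\langle\bar A\rangle$ be the $\mathcal{L}_{MO}$-structure on all subsets of $\langle\bar A\rangle$ (inclusion, and $\overset{\exists}{<}$ from the order of $\mathbb{I}$), expanded by the constants $c_k\mapsto A_k$; this is an algebra of sets. An acceptable sequence is $\zeta(\bar x)=(\Phi(Y_1,\dots,Y_m),\theta_1(\bar x),\dots,\theta_m(\bar x))$ with $\Phi$ a formula in the signature $\{\subseteq,\overset{\exists}{<},c_1,\dots,c_n\}$ and the $\theta_k$ $\mathcal{L}_{MO}$-formulas. The generalised power $W(\mathbb{I})^{(\bar A)}$ is the structure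 with universe the set of functions $f:\langle\bar A\rangle\to\mathcal{P}_{\mathrm{fin}}(\mathbb{I})$ and, for each acceptable sequence $\zeta$, a relation $R_\zeta$ holding at $\bar f$ iff $W\langle\bar A\rangle\models\Phi(\|\theta_1(\bar f)\|,\dots,\|\theta_m(\bar f)\|)$, where $\|\theta(\bar f)\|=\{i\in\langle\bar A\rangle: W(\mathbb{I})\models\theta(\bar f(i))\}$. For $i\in\langle\bar A\rangle$ let $j$ be the successor of $i$ in $\langle\bar A\rangle$ (or $j=+\infty$ if $i=\max\langle\bar A\rangle$), and fix an isomorphism of $\mathcal{L}_{MO}$-structures $h_i:W(\mathbb{I})\to W([i,j))$, where $[i,j)=\{k\in\mathbb{I}:i\le k<j\}$ (such exist since $\mathbb{I}$ is countable). Define the bijection $g_{\bar A}$ from the universe of $W(\mathbb{I})^{(\bar A)}$ onto $\mathcal{P}_{\mathrm{fin}}(\mathbb{I})$ by $g_{\bar A}(f)=\bigcup_{i\in\langle\bar A\rangle}h_i(f(i))$. Two structures (possibly in different signatures) are definitionally equivalent over a bijection if, after identifying universes via the bijection, each atomic formula of either signature defines the same set as some formula of the other signature (equivalently, the definable sets coincide). -}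

module Defs where

open import Level using (Level; _⊔_; Lift; lift) renaming (suc to lsuc; zero to lzero)
open import Data.Nat using (ℕ; zero; suc)
open import Data.Fin using (Fin; zero; suc)
open import Data.Empty using (⊥)
open import Data.Product using (Σ; ∃; _×_; _,_)
open import Data.Sum using (_⊎_)
open import Data.List using (List; _∷_; concatMap; allFin)
open import Data.List.Relation.Unary.All using (All)
open import Relation.Nullary using (¬_)
open import Relation.Binary.PropositionalEquality using (_≡_)
open import Relation.Binary.Structures using (IsStrictTotalOrder)
open import Function.Bundles using (_↠_)
import Data.Unit.Polymorphic as U
import Data.Empty.Polymorphic as E
open import Data.Vec.Functional using () renaming (_∷_ to _∷ᵥ_)

record Sig : Set₁ where
  field
    Rel   : ℕ → Set
    Const : Set
open Sig public

data Term (σ : Sig) (k : ℕ) : Set where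
  var : Fin k → Term σ k
  con : Const σ → Term σ k

infixr 6 _∧'_
infixr 5 _∨'_
infixr 4 _⇒'_
data Fm (σ : Sig) : ℕ → Set where
  rel  : ∀ {k p} → Rel σ p → (Fin p → Term σ k) → Fm σ k
  _≐_  : ∀ {k} → Term σ k → Term σ k → Fm σ k
  ⊤' ⊥' : ∀ {k} → Fm σ k
  ¬'_  : ∀ {k} → Fm σ k → Fm σ k
  _∧'_ _∨'_ _⇒'_ : ∀ {k} → Fm σ k → Fm σ k → Fm σ k
  ∀' ∃' : ∀ {k} → Fm σ (suc k) → Fm σ k

data IsAtomic {σ : Sig} {k : ℕ} : Fm σ k → Set where
  rel-atomic : ∀ {p} (R : Rel σ p) (ts : Fin p → Term σ k) → IsAtomic (rel R ts)
  eq-atomic  : (s t : Term σ k) → IsAtomic (s ≐ t)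

-- A structure for a signature; equality is interpreted by a relation _≈_
-- (a congruence in all instances below), so a structure represents its
-- quotient by _≈_.
record Str (σ : Sig) (a ℓ : Level) : Set (lsuc (a ⊔ ℓ)) where
  field
    Carrier : Set a
    _≈_     : Carrier → Carrier → Set ℓ
    relI    : ∀ {p} → Rel σ p → (Fin p → Carrier) → Set ℓ
    constI  : Const σ → Carrier
open Str public

module _ {σ : Sig} {a ℓ : Level} (M : Str σ a ℓ) where
  evalT : ∀ {k} → (Fin k → Carrier M) → Term σ k → Carrier M
  evalT ρ (var x) = ρ x
  evalT ρ (con c) = constI M c

  ⟦_⟧ : ∀ {k} → Fm σ k → (Fin k → Carrier M) → Set (a ⊔ ℓ)
  ⟦ rel R ts ⟧ ρ = Lift a (relI M R (λ i → evalT ρ (ts i)))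
  ⟦ s ≐ t ⟧ ρ = Lift a (_≈_ M (evalT ρ s) (evalT ρ t))
  ⟦ ⊤' ⟧ ρ = U.⊤
  ⟦ ⊥' ⟧ ρ = E.⊥
  ⟦ ¬' φ ⟧ ρ = ⟦ φ ⟧ ρ → E.⊥ {a ⊔ ℓ}
  ⟦ φ ∧' ψ ⟧ ρ = ⟦ φ ⟧ ρ × ⟦ ψ ⟧ ρ
  ⟦ φ ∨' ψ ⟧ ρ = ⟦ φ ⟧ ρ ⊎ ⟦ ψ ⟧ ρ
  ⟦ φ ⇒' ψ ⟧ ρ = ⟦ φ ⟧ ρ → ⟦ ψ ⟧ ρ
  ⟦ ∀' φ ⟧ ρ = (d : Carrier M) → ⟦ φ ⟧ (d ∷ᵥ ρ)
  ⟦ ∃' φ ⟧ ρ = Σ (Carrier M) (λ d → ⟦ φ ⟧ (d ∷ᵥ ρ))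

_⇔_ : ∀ {a b} → Set a → Set b → Set (a ⊔ b)
A ⇔ B = (A → B) × (B → A)

data MORel : ℕ → Set where
  ⊆R  : MORel 2
  ∃<R : MORel 2

MOsig : ℕ → Sig
MOsig n = record { Rel = MORel ; Const = Fin n }

LMO : Sig
LMO = MOsig 0

-- Acceptable sequences ζ(x̄) = (Φ(Y_1..Y_m), θ_1(x̄),…,θ_m(x̄)) with x̄ of
-- length p: Φ in {⊆, ∃<, c_1..c_n} with free variables among Y_1..Y_m,
-- θ_k pure L_MO-formulas with free variables among x_1..x_p.
record Acceptable (n p : ℕ) : Set where
  field
    m : ℕ
    Φ : Fm (MOsig n) m
    θ : Fin m → Fm LMO p

GPsig : ℕ → Sig
GPsig n = record { Rel = Acceptable n ; Const = ⊥ }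

record CountableDLO : Set₁ where
  field
    I       : Set
    _<_     : I → I → Set
    isSTO   : IsStrictTotalOrder _≡_ _<_
    dense   : ∀ {x y} → x < y → ∃ λ z → (x < z) × (z < y)
    0I      : I
    least   : ∀ x → ¬ (x < 0I)
    noMax   : ∀ x → ∃ λ y → x < y
    countable : ℕ ↠ I

module Over (𝕀 : CountableDLO) where
  open CountableDLO 𝕀
  open import Data.List.Membership.Propositional using (_∈_)
  open import Data.List.Relation.Binary.Subset.Propositional using (_⊆_)

  _≤_ : I → I → Set
  x ≤ y = (x ≡ y) ⊎ (x < y)

  -- finite subsets of 𝕀, represented by lists (equality = same elements)
  FinSet : Set
  FinSet = List I

  _≈F_ : FinSet → FinSet → Set
  A ≈F B = (A ⊆ B) × (B ⊆ A)

  _∃<_ : FinSet → FinSet → Set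
  A ∃< B = Σ I λ i → Σ I λ j → (i ∈ A) × (j ∈ B) × (i < j)

  -- W(𝕀) expanded by constants naming A_1..A_n  (n = 0 gives W(𝕀))
  W : ∀ {n} → (Fin n → FinSet) → Str (MOsig n) lzero lzero
  W A = record
    { Carrier = FinSet
    ; _≈_ = _≈F_
    ; relI = λ { ⊆R xs → xs zero ⊆ xs (suc zero) ; ∃<R xs → xs zero ∃< xs (suc zero) }
    ; constI = A
    }

  W𝕀 : Str LMO lzero lzero
  W𝕀 = W (λ ())

  _∈⟨_⟩ : ∀ {n} → I → (Fin n → FinSet) → Set
  i ∈⟨ A ⟩ = (i ≡ 0I) ⊎ Σ (Fin _) (λ k → i ∈ A k)

  ⟨_⟩list : ∀ {n} → (Fin n → FinSet) → List I
  ⟨_⟩list {n} A = 0I ∷ concatMap A (allFin n)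

  -- W⟨Ā⟩: the algebra of all subsets of ⟨Ā⟩ (subsets given as predicates,
  -- two predicates being equal iff they agree on ⟨Ā⟩), with constants A_k.
  W⟨_⟩ : ∀ {n} → (Fin n → FinSet) → Str (MOsig n) (lsuc lzero) lzero
  W⟨_⟩ A = record
    { Carrier = I → Set
    ; _≈_ = λ S T → (∀ i → i ∈⟨ A ⟩ → S i → T i) × (∀ i → i ∈⟨ A ⟩ → T i → S i)
    ; relI = λ { ⊆R xs → ∀ i → i ∈⟨ A ⟩ → xs zero i → xs (suc zero) i
               ; ∃<R xs → Σ I λ i → Σ I λ j → i ∈⟨ A ⟩ × j ∈⟨ A ⟩
                            × xs zero i × xs (suc zero) j × (i < j) }
    ; constI = λ k i → i ∈ A k
    }

  ‖_‖ : ∀ {n p} (A : Fin n → FinSet) → Fm LMO p → (Fin p → I → FinSet) → I → Set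
  ‖_‖ A θ fs i = (i ∈⟨ A ⟩) × ⟦ W𝕀 ⟧ θ (λ l → fs l i)

  -- The generalised power W(𝕀)^(Ā): universe = functions ⟨Ā⟩ → P_fin(𝕀)
  -- (represented by functions I → FinSet, equal iff they agree on ⟨Ā⟩).
  GP : ∀ {n} → (Fin n → FinSet) → Str (GPsig n) lzero (lsuc lzero)
  GP {n} A = record
    { Carrier = I → FinSet
    ; _≈_ = λ f g → Lift (lsuc lzero) (∀ i → i ∈⟨ A ⟩ → f i ≈F g i)
    ; relI = λ ζ fs → ⟦ W⟨ A ⟩ ⟧ (Acceptable.Φ ζ) (λ k → ‖ A ‖ (Acceptable.θ ζ k) fs)
    ; constI = λ ()
    }

  -- [i, j) where j is the successor of i in ⟨Ā⟩ (j = +∞ if i is the maximum)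
  InSuccInterval : ∀ {n} → (Fin n → FinSet) → I → I → Set
  InSuccInterval A i x = (i ≤ x) × (∀ a → a ∈⟨ A ⟩ → i < a → x < a)

  -- H is an isomorphism of L_MO-structures W(𝕀) → W(P) where P ⊆ 𝕀
  -- (W(P) = finite subsets of 𝕀 contained in P).
  record IsWIso (P : I → Set) (H : FinSet → FinSet) : Set where
    field
      into      : ∀ B x → x ∈ H B → P x
      onto      : ∀ C → All P C → Σ FinSet λ B → H B ≈F C
      pres-⊆    : ∀ B C → (B ⊆ C) ⇔ (H B ⊆ H C)
      pres-∃<   : ∀ B C → (B ∃< C) ⇔ (H B ∃< H C)

  IsoFamily : ∀ {n} → (Fin n → FinSet) → (I → FinSet → FinSet) → Set
  IsoFamily A h = ∀ i → i ∈⟨ A ⟩ → IsWIso (InSuccInterval A i) (h i)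

  g : ∀ {n} → (Fin n → FinSet) → (I → FinSet → FinSet) → (I → FinSet) → FinSet
  g A h f = concatMap (λ i → h i (f i)) ⟨ A ⟩list

-- The bijection g_Ā glues copies of W(𝕀): h_i places f(i) into the interval [i, j) between a
-- point i of ⟨Ā⟩ and its successor j. Hence g(f) ⊆ g(f′) iff f(i) ⊆ f′(i) at every point i,
-- and g(f) ∃< g(f′) iff f(i) ∃< f′(i) at some point i, or f(i) and f′(j) are non-empty for some
-- points i < j; both are relations R_ζ, and the constant A_c is the image of the function that is
-- {0} on A_c and ∅ elsewhere. Conversely, in (W(𝕀), Ā) the points of ⟨Ā⟩ are definable as
-- singletons, a subset of ⟨Ā⟩ is coded by a finite set of points, and since h_i is an
-- isomorphism, W(𝕀) ⊨ θ(f̄(i)) says that θ relativised to [i, j) holds of g(f̄). None of the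
-- formulas depends on Ā.

module Submission where

open import Defs
open import Level using (Level; 0ℓ; Lift; lift; lower) renaming (suc to lsuc)
open import Data.Nat using (ℕ; zero; suc)
open import Data.Fin using (Fin; zero; suc)
import Data.Fin as Fin
open import Data.Product using (Σ; _×_; _,_; proj₁; proj₂)
import Data.Product as Product
open import Data.Sum using (_⊎_; inj₁; inj₂)
import Data.Sum as Sum
open import Data.List using (List; []; _∷_; [_]; allFin; filter)
open import Data.List.Relation.Unary.Any using (here; there)
open import Data.List.Relation.Unary.Any.Properties using (singleton⁻; ¬Any[])
open import Data.List.Membership.Propositional using (_∈_; find; lose)
open import Data.List.Membership.Propositional.Properties
  using (∈-concatMap⁺; ∈-concatMap⁻; ∈-allFin; ∈-filter⁺; ∈-filter⁻)
open import Data.List.Relation.Binary.Subset.Propositional using (_⊆_)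
open import Data.List.Relation.Binary.Subset.Propositional.Properties using (⊆-refl; ⊆-trans)
open import Relation.Binary.PropositionalEquality using (_≡_; refl; sym; subst)
open import Relation.Nullary using (¬_; yes; no)
open import Relation.Binary.Definitions using (tri<; tri≈; tri>)
open import Relation.Binary.Structures using (IsStrictTotalOrder)
open import Data.Empty using (⊥; ⊥-elim)
import Data.Empty.Polymorphic as E
import Data.Unit.Polymorphic as U
import Data.List.Relation.Unary.All as All
open import Data.Vec.Functional using () renaming (_∷_ to _∷ᵥ_; [] to []ᵥ)
open import Function using (_∘_; id)
open import Axiom.ExcludedMiddle using (ExcludedMiddle)

⇔-refl : ∀ {a} {P : Set a} → P ⇔ P
⇔-refl = id , id

⇔-sym : ∀ {a b} {P : Set a} {Q : Set b} → P ⇔ Q → Q ⇔ P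
⇔-sym = Product.swap

⇔-trans : ∀ {a b c} {P : Set a} {Q : Set b} {R : Set c} → P ⇔ Q → Q ⇔ R → P ⇔ R
⇔-trans (f , g) (f′ , g′) = f′ ∘ f , g ∘ g′

Lift-⇔ : ∀ {a b ℓ} {P : Set a} {Q : Set b} → P ⇔ Q → Lift ℓ P ⇔ Q
Lift-⇔ (f , g) = f ∘ lower , lift ∘ g

⇔-Lift : ∀ {a b ℓ} {P : Set a} {Q : Set b} → P ⇔ Q → P ⇔ Lift ℓ Q
⇔-Lift (f , g) = lift ∘ f , g ∘ lower

Σ-cong-⇔ : ∀ {a b c} {A : Set a} {P : A → Set b} {Q : A → Set c} →
           (∀ x → P x ⇔ Q x) → Σ A P ⇔ Σ A Q
Σ-cong-⇔ P⇔Q = Product.map id (λ {x} → proj₁ (P⇔Q x)) , Product.map id (λ {x} → proj₂ (P⇔Q x))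

module _ {a b c d : Level} {P : Set a} {Q : Set b} {P′ : Set c} {Q′ : Set d} where

  ×-cong-⇔ : P ⇔ Q → P′ ⇔ Q′ → (P × P′) ⇔ (Q × Q′)
  ×-cong-⇔ (f , g) (f′ , g′) = Product.map f f′ , Product.map g g′

  ⊎-cong-⇔ : P ⇔ Q → P′ ⇔ Q′ → (P ⊎ P′) ⇔ (Q ⊎ Q′)
  ⊎-cong-⇔ (f , g) (f′ , g′) = Sum.map f f′ , Sum.map g g′

  →-cong-⇔ : P ⇔ Q → P′ ⇔ Q′ → (P → P′) ⇔ (Q → Q′)
  →-cong-⇔ (f , g) (f′ , g′) = (λ u → f′ ∘ u ∘ g) , (λ v → g′ ∘ v ∘ f)

¬-cong-⇔ : ∀ {a b ℓ ℓ′} {P : Set a} {Q : Set b} → P ⇔ Q → (P → E.⊥ {ℓ}) ⇔ (Q → E.⊥ {ℓ′})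
¬-cong-⇔ (f , g) = (λ ¬p → E.⊥-elim ∘ ¬p ∘ g) , (λ ¬q → E.⊥-elim ∘ ¬q ∘ f)

⊤-cong-⇔ : ∀ {a b} → U.⊤ {a} ⇔ U.⊤ {b}
⊤-cong-⇔ = _ , _

⊥-cong-⇔ : ∀ {a b} → E.⊥ {a} ⇔ E.⊥ {b}
⊥-cong-⇔ = E.⊥-elim , E.⊥-elim

renameT : ∀ {σ k k′} → (Fin k → Fin k′) → Term σ k → Term σ k′
renameT r (var x) = var (r x)
renameT r (con c) = con c

rename : ∀ {σ k k′} → (Fin k → Fin k′) → Fm σ k → Fm σ k′
rename r (rel R ts) = rel R (renameT r ∘ ts)
rename r (s ≐ t) = renameT r s ≐ renameT r t
rename r ⊤' = ⊤'
rename r ⊥' = ⊥'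
rename r (¬' φ) = ¬' rename r φ
rename r (φ ∧' ψ) = rename r φ ∧' rename r ψ
rename r (φ ∨' ψ) = rename r φ ∨' rename r ψ
rename r (φ ⇒' ψ) = rename r φ ⇒' rename r ψ
rename r (∀' φ) = ∀' (rename (Fin.lift 1 r) φ)
rename r (∃' φ) = ∃' (rename (Fin.lift 1 r) φ)

evalT-renameT : ∀ {σ a ℓ} (M : Str σ a ℓ) {k k′} (r : Fin k → Fin k′) ρ t →
                evalT M ρ (renameT r t) ≡ evalT M (ρ ∘ r) t
evalT-renameT M r ρ (var x) = refl
evalT-renameT M r ρ (con c) = refl

weaken₂ : ∀ {σ k} → Term σ k → Term σ (suc (suc k))
weaken₂ = renameT (λ x → suc (suc x))

⋁ : ∀ {σ k m} → (Fin m → Fm σ k) → Fm σ k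
⋁ {m = zero} φs = ⊥'
⋁ {m = suc m} φs = φs zero ∨' ⋁ (φs ∘ suc)

⋁-sem : ∀ {σ a ℓ} (M : Str σ a ℓ) {k m} (φs : Fin m → Fm σ k) ρ →
        ⟦ M ⟧ (⋁ φs) ρ ⇔ Σ (Fin m) (λ j → ⟦ M ⟧ (φs j) ρ)
⋁-sem M {m = zero} φs ρ = (λ ()) , (λ ())
⋁-sem M {m = suc m} φs ρ =
  (λ { (inj₁ p) → zero , p ; (inj₂ q) → Product.map suc id (proj₁ (⋁-sem M (φs ∘ suc) ρ) q) }) ,
  (λ { (zero , p) → inj₁ p ; (suc j , p) → inj₂ (proj₂ (⋁-sem M (φs ∘ suc) ρ) (j , p)) })

infix 7 _⊆'_ _∃<'_

_⊆'_ _∃<'_ : ∀ {n k} → Term (MOsig n) k → Term (MOsig n) k → Fm (MOsig n) k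
s ⊆' t = rel ⊆R (s ∷ᵥ t ∷ᵥ []ᵥ)
s ∃<' t = rel ∃<R (s ∷ᵥ t ∷ᵥ []ᵥ)

NonEmpty IsEmpty IsTop IsSingleton IsLeast IsZero : ∀ {n k} → Fin k → Fm (MOsig n) k
NonEmpty x = ∃' (¬' (var (suc x) ⊆' var zero))
IsEmpty x = ∀' (var (suc x) ⊆' var zero)
IsTop x = ∀' (var zero ⊆' var (suc x))
IsSingleton x = NonEmpty x ∧' ∀' (var zero ⊆' var (suc x) ⇒' var (suc x) ⊆' var zero ∨' IsEmpty zero)
IsLeast x = ∀' (IsSingleton zero ⇒' ¬' (var zero ∃<' var (suc x)))
IsZero x = IsSingleton x ∧' IsLeast x

varOfLMO : ∀ {k} → Term LMO k → Fin k
varOfLMO (var x) = x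
varOfLMO (con ())

varOfGP : ∀ {n k} → Term (GPsig n) k → Fin k
varOfGP (var x) = x
varOfGP (con ())

-- An element i of 𝕀 is handled through the singleton {i}; the points are the i ∈ ⟨Ā⟩.
module _ {n : ℕ} where

  IsPoint : ∀ {k} → Fin k → Fm (MOsig n) k
  IsPoint x = IsSingleton x ∧' (IsLeast x ∨' ⋁ (λ c → var x ⊆' con c))

  ElementOf : ∀ {k} → Fin k → Fm (MOsig n) (suc k)
  ElementOf u = IsSingleton zero ∧' var zero ⊆' var (suc u)

  -- For a = {i} and b = {y} with i a point: y ∈ [i, j), j the successor of i in ⟨Ā⟩.
  InInterval : ∀ {k} → Fin k → Fin k → Fm (MOsig n) k
  InInterval a b = (var a ≐ var b ∨' var a ∃<' var b) ∧'
                   ∀' (IsPoint zero ⇒' var (suc a) ∃<' var zero ⇒' var (suc b) ∃<' var zero)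

  InsideInterval : ∀ {k} → Fin k → Fin k → Fm (MOsig n) k
  InsideInterval a u = ∀' (ElementOf u ⇒' InInterval (suc a) zero)

  SubsetOn ExistsLessOn : ∀ {k} → Fin k → Fin k → Fin k → Fm (MOsig n) k
  SubsetOn a s t = ∀' (ElementOf s ⇒' InInterval (suc a) zero ⇒' var zero ⊆' var (suc t))
  ExistsLessOn a s t =
    ∃' (ElementOf s ∧' InInterval (suc a) zero ∧'
        ∃' (ElementOf (suc t) ∧' InInterval (suc (suc a)) zero ∧' var (suc zero) ∃<' var zero))

  -- θ evaluated in the copy W([i, j)) of W(𝕀), where a = {i}: the variable x of θ is read off
  -- the restriction to [i, j) of the variable σ x.
  relativise : ∀ {p q} → Fm LMO p → (Fin p → Fin q) → Fin q → Fm (MOsig n) q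
  relativise (rel ⊆R ts) σ a = SubsetOn a (σ (varOfLMO (ts zero))) (σ (varOfLMO (ts (suc zero))))
  relativise (rel ∃<R ts) σ a = ExistsLessOn a (σ (varOfLMO (ts zero))) (σ (varOfLMO (ts (suc zero))))
  relativise (s ≐ t) σ a = SubsetOn a (σ (varOfLMO s)) (σ (varOfLMO t)) ∧'
                           SubsetOn a (σ (varOfLMO t)) (σ (varOfLMO s))
  relativise ⊤' σ a = ⊤'
  relativise ⊥' σ a = ⊥'
  relativise (¬' φ) σ a = ¬' relativise φ σ a
  relativise (φ ∧' ψ) σ a = relativise φ σ a ∧' relativise ψ σ a
  relativise (φ ∨' ψ) σ a = relativise φ σ a ∨' relativise ψ σ a
  relativise (φ ⇒' ψ) σ a = relativise φ σ a ⇒' relativise ψ σ a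
  relativise (∀' φ) σ a = ∀' (InsideInterval (suc a) zero ⇒' relativise φ (Fin.lift 1 σ) (suc a))
  relativise (∃' φ) σ a = ∃' (InsideInterval (suc a) zero ∧' relativise φ (Fin.lift 1 σ) (suc a))

  OnlyPoints : ∀ {k} → Fin k → Fm (MOsig n) k
  OnlyPoints u = ∀' (ElementOf u ⇒' IsPoint zero)

  memberOf : ∀ {m q} → (Fin m → Fm (MOsig n) (suc q)) → Term (MOsig n) m → Fm (MOsig n) (suc q)
  memberOf mem (var v) = mem v
  memberOf mem (con c) = var zero ⊆' con c

  extendMember : ∀ {m q} → (Fin m → Fm (MOsig n) (suc q)) → Fin (suc m) → Fm (MOsig n) (suc (suc q))
  extendMember mem zero = var zero ⊆' var (suc zero)
  extendMember mem (suc v) = rename (Fin.lift 1 suc) (mem v)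

  -- A formula about subsets of ⟨Ā⟩, each coded by the finite set of its points; mem v, with a
  -- point in variable 0, says that the point lies in the v-th set variable.
  onPoints : ∀ {m q} → Fm (MOsig n) m → (Fin m → Fm (MOsig n) (suc q)) → Fm (MOsig n) q
  onPoints (rel ⊆R ts) mem = ∀' (IsPoint zero ⇒' memberOf mem (ts zero) ⇒' memberOf mem (ts (suc zero)))
  onPoints (rel ∃<R ts) mem =
    ∃' (IsPoint zero ∧' memberOf mem (ts zero) ∧'
        ∃' (IsPoint zero ∧' rename (Fin.lift 1 suc) (memberOf mem (ts (suc zero))) ∧'
            var (suc zero) ∃<' var zero))
  onPoints (s ≐ t) mem =
    ∀' (IsPoint zero ⇒' (memberOf mem s ⇒' memberOf mem t) ∧' (memberOf mem t ⇒' memberOf mem s))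
  onPoints ⊤' mem = ⊤'
  onPoints ⊥' mem = ⊥'
  onPoints (¬' φ) mem = ¬' onPoints φ mem
  onPoints (φ ∧' ψ) mem = onPoints φ mem ∧' onPoints ψ mem
  onPoints (φ ∨' ψ) mem = onPoints φ mem ∨' onPoints ψ mem
  onPoints (φ ⇒' ψ) mem = onPoints φ mem ⇒' onPoints ψ mem
  onPoints (∀' φ) mem = ∀' (OnlyPoints zero ⇒' onPoints φ (extendMember mem))
  onPoints (∃' φ) mem = ∃' (OnlyPoints zero ∧' onPoints φ (extendMember mem))

  translateR : ∀ {k p} → Acceptable n p → (Fin p → Term (GPsig n) k) → Fm (MOsig n) k
  translateR ζ ts = onPoints Φ (λ l → relativise (θ l) (suc ∘ varOfGP ∘ ts) zero)
    where open Acceptable ζ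

  fromGP : ∀ {k} {ψ : Fm (GPsig n) k} → IsAtomic ψ → Fm (MOsig n) k
  fromGP (rel-atomic ζ ts) = translateR ζ ts
  fromGP (eq-atomic s t) = var (varOfGP s) ≐ var (varOfGP t)

  ζ-⊆ ζ-∃< : Acceptable n 2
  ζ-⊆ = record { m = 1 ; Φ = IsTop zero ; θ = λ _ → var zero ⊆' var (suc zero) }
  ζ-∃< = record { m = 3 ; Φ = var (suc zero) ∃<' var (suc (suc zero)) ∨' NonEmpty zero ; θ = θs }
    where
      θs : Fin 3 → Fm LMO 2
      θs zero = var zero ∃<' var (suc zero)
      θs (suc zero) = NonEmpty zero
      θs (suc (suc zero)) = NonEmpty (suc zero)

  -- A_c is denoted by the function that is {0} on A_c and ∅ elsewhere, as h_i maps {0} to {i}.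
  ζ-const : Fin n → Acceptable n 1
  ζ-const c = record { m = 2 ; Φ = var zero ≐ con c ∧' IsTop (suc zero) ; θ = θs }
    where
      θs : Fin 2 → Fm LMO 1
      θs zero = IsZero zero
      θs (suc zero) = IsZero zero ∨' IsEmpty zero

  Denotes : ∀ {k} → Term (MOsig n) k → Fin k → Fm (GPsig n) k
  Denotes (var x) z = var z ≐ var x
  Denotes (con c) z = rel (ζ-const c) (var z ∷ᵥ []ᵥ)

  ViaDenotations : ∀ {k} → Fm (GPsig n) (suc (suc k)) → Term (MOsig n) k → Term (MOsig n) k → Fm (GPsig n) k
  ViaDenotations R s t = ∃' (∃' (Denotes (weaken₂ s) (suc zero) ∧'
                                 Denotes (weaken₂ t) zero ∧' R))

  rel₁₀ : ∀ {k} → Acceptable n 2 → Fm (GPsig n) (suc (suc k))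
  rel₁₀ ζ = rel ζ (var (suc zero) ∷ᵥ var zero ∷ᵥ []ᵥ)

  fromMO : ∀ {k} {α : Fm (MOsig n) k} → IsAtomic α → Fm (GPsig n) k
  fromMO (rel-atomic ⊆R ts) = ViaDenotations (rel₁₀ ζ-⊆) (ts zero) (ts (suc zero))
  fromMO (rel-atomic ∃<R ts) = ViaDenotations (rel₁₀ ζ-∃<) (ts zero) (ts (suc zero))
  fromMO (eq-atomic s t) = ViaDenotations (var (suc zero) ≐ var zero) s t

module _ (𝕀 : CountableDLO) where
  open CountableDLO 𝕀
  open Over 𝕀
  open IsStrictTotalOrder isSTO using (compare; irrefl; asym) renaming (trans to <-trans)

  <-≤-trans : ∀ {x y z} → x < y → y ≤ z → x < z
  <-≤-trans p (inj₁ refl) = p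
  <-≤-trans p (inj₂ q) = <-trans p q

  ≤⇒≯ : ∀ {x y} → x ≤ y → ¬ (y < x)
  ≤⇒≯ (inj₁ refl) = irrefl refl
  ≤⇒≯ (inj₂ p) = asym p

  ≈F-refl : ∀ {B} → B ≈F B
  ≈F-refl = ⊆-refl , ⊆-refl

  ≈F-reflexive : ∀ {B C} → B ≡ C → B ≈F C
  ≈F-reflexive refl = ≈F-refl

  ≈F-sym : ∀ {B C} → B ≈F C → C ≈F B
  ≈F-sym (p , q) = q , p

  ≈F-trans : ∀ {B C D} → B ≈F C → C ≈F D → B ≈F D
  ≈F-trans (p , q) (p′ , q′) = ⊆-trans p p′ , ⊆-trans q′ q

  ⊆-resp-≈F : ∀ {B B′ C C′} → B ≈F B′ → C ≈F C′ → B ⊆ C → B′ ⊆ C′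
  ⊆-resp-≈F (_ , q) (p , _) s = ⊆-trans q (⊆-trans s p)

  ∃<-resp-≈F : ∀ {B B′ C C′} → B ≈F B′ → C ≈F C′ → B ∃< C → B′ ∃< C′
  ∃<-resp-≈F (p , _) (p′ , _) (i , j , i∈ , j∈ , i<j) = i , j , p i∈ , p′ j∈ , i<j

  ≈F-resp-≈F : ∀ {B B′ C C′} → B ≈F B′ → C ≈F C′ → B ≈F C → B′ ≈F C′
  ≈F-resp-≈F e e′ e″ = ≈F-trans (≈F-sym e) (≈F-trans e″ e′)

  ∈⇒singleton-⊆ : ∀ {y : I} {L} → y ∈ L → [ y ] ⊆ L
  ∈⇒singleton-⊆ y∈L (here refl) = y∈L

  ⊈⇒element : ∀ {L z : FinSet} → ¬ (L ⊆ z) → Σ I (_∈ L)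
  ⊈⇒element {[]} []⊈z = ⊥-elim ([]⊈z (λ ()))
  ⊈⇒element {e ∷ _} _ = e , here refl

  constant⇒≈F-singleton : ∀ {L y} → Σ I (_∈ L) → (∀ {x} → x ∈ L → x ≡ y) → L ≈F [ y ]
  constant⇒≈F-singleton (x , x∈) const =
    (λ x′∈ → here (const x′∈)) , (λ { (here refl) → subst (_∈ _) (const x∈) x∈ })

  singleton-⊆⇔∈ : ∀ {L X y} → L ≈F [ y ] → (L ⊆ X) ⇔ (y ∈ X)
  proj₁ (singleton-⊆⇔∈ e) s = s (proj₂ e (here refl))
  proj₂ (singleton-⊆⇔∈ {X = X} e) y∈X p = subst (_∈ X) (sym (singleton⁻ (proj₁ e p))) y∈X

  singleton-∃<⇔< : ∀ {L L′ y y′} → L ≈F [ y ] → L′ ≈F [ y′ ] → (L ∃< L′) ⇔ (y < y′)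
  proj₁ (singleton-∃<⇔< e e′) (_ , _ , p , q , lt)
    with singleton⁻ (proj₁ e p) | singleton⁻ (proj₁ e′ q)
  ... | refl | refl = lt
  proj₂ (singleton-∃<⇔< {y = y} {y′} e e′) lt = y , y′ , proj₂ e (here refl) , proj₂ e′ (here refl) , lt

  singleton-≈F⇔≡ : ∀ {L L′ y y′} → L ≈F [ y ] → L′ ≈F [ y′ ] → (L ≈F L′) ⇔ (y ≡ y′)
  proj₁ (singleton-≈F⇔≡ e e′) e″ = singleton⁻ (proj₁ e′ (proj₁ e″ (proj₂ e (here refl))))
  proj₂ (singleton-≈F⇔≡ e e′) refl = ≈F-trans e (≈F-sym e′)

  module WFormulas {m} (B : Fin m → FinSet) where

    relI-resp-≈F : ∀ {p} (R : MORel p) {xs ys} → (∀ l → xs l ≈F ys l) →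
                   relI (W B) R xs → relI (W B) R ys
    relI-resp-≈F ⊆R e = ⊆-resp-≈F (e zero) (e (suc zero))
    relI-resp-≈F ∃<R e = ∃<-resp-≈F (e zero) (e (suc zero))

    evalT-rename-≈F : ∀ {k k′} (r : Fin k → Fin k′) {ρ ρ′} → (∀ x → ρ′ (r x) ≈F ρ x) →
                      ∀ t → evalT (W B) ρ′ (renameT r t) ≈F evalT (W B) ρ t
    evalT-rename-≈F r e (var x) = e x
    evalT-rename-≈F r e (con c) = ≈F-refl

    ∷-rename-≈F : ∀ {k k′} {r : Fin k → Fin k′} {ρ ρ′} → (∀ x → ρ′ (r x) ≈F ρ x) →
                  ∀ d x → (d ∷ᵥ ρ′) (Fin.lift 1 r x) ≈F (d ∷ᵥ ρ) x
    ∷-rename-≈F e d zero = ≈F-refl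
    ∷-rename-≈F e d (suc x) = e x

    rename-sem : ∀ {k k′} (φ : Fm (MOsig m) k) (r : Fin k → Fin k′) {ρ ρ′} →
                 (∀ x → ρ′ (r x) ≈F ρ x) → ⟦ W B ⟧ (rename r φ) ρ′ ⇔ ⟦ W B ⟧ φ ρ
    rename-sem (rel R ts) r e =
      (λ (lift s) → lift (relI-resp-≈F R (evalT-rename-≈F r e ∘ ts) s)) ,
      (λ (lift s) → lift (relI-resp-≈F R (≈F-sym ∘ evalT-rename-≈F r e ∘ ts) s))
    rename-sem (s ≐ t) r e =
      (λ (lift q) → lift (≈F-resp-≈F (E s) (E t) q)) ,
      (λ (lift q) → lift (≈F-resp-≈F (≈F-sym (E s)) (≈F-sym (E t)) q))
      where E = evalT-rename-≈F r e
    rename-sem ⊤' r e = ⊤-cong-⇔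
    rename-sem ⊥' r e = ⊥-cong-⇔
    rename-sem (¬' φ) r e = ¬-cong-⇔ (rename-sem φ r e)
    rename-sem (φ ∧' ψ) r e = ×-cong-⇔ (rename-sem φ r e) (rename-sem ψ r e)
    rename-sem (φ ∨' ψ) r e = ⊎-cong-⇔ (rename-sem φ r e) (rename-sem ψ r e)
    rename-sem (φ ⇒' ψ) r e = →-cong-⇔ (rename-sem φ r e) (rename-sem ψ r e)
    rename-sem (∀' φ) r e =
      (λ f d → proj₁ (rename-sem φ _ (∷-rename-≈F e d)) (f d)) ,
      (λ f d → proj₂ (rename-sem φ _ (∷-rename-≈F e d)) (f d))
    rename-sem (∃' φ) r e =
      (λ (d , p) → d , proj₁ (rename-sem φ _ (∷-rename-≈F e d)) p) ,
      (λ (d , p) → d , proj₂ (rename-sem φ _ (∷-rename-≈F e d)) p)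

    weakenUnder-sem : ∀ {k} (φ : Fm (MOsig m) (suc k)) b d ρ →
                      ⟦ W B ⟧ (rename (Fin.lift 1 suc) φ) (b ∷ᵥ d ∷ᵥ ρ) ⇔ ⟦ W B ⟧ φ (b ∷ᵥ ρ)
    weakenUnder-sem φ b d ρ = rename-sem φ (Fin.lift 1 suc) (∷-rename-≈F (λ _ → ≈F-refl) b)

    nonEmpty-sem : ∀ {k} (ρ : Fin k → FinSet) x → ⟦ W B ⟧ (NonEmpty x) ρ ⇔ Σ I (_∈ ρ x)
    proj₁ (nonEmpty-sem ρ x) (_ , ρx⊈z) = ⊈⇒element (lower ∘ ρx⊈z ∘ lift)
    proj₂ (nonEmpty-sem ρ x) (y , y∈) = [] , λ (lift s) → lift (¬Any[] (s y∈))

    isEmpty-sem : ∀ {k} (ρ : Fin k → FinSet) x → ⟦ W B ⟧ (IsEmpty x) ρ ⇔ (ρ x ⊆ [])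
    isEmpty-sem ρ x = (λ f → lower (f [])) , (λ s _ → lift (⊥-elim ∘ ¬Any[] ∘ s))

    isSingleton-sem : ∀ {k} (ρ : Fin k → FinSet) x →
                      ⟦ W B ⟧ (IsSingleton x) ρ ⇔ Σ I (λ y → ρ x ≈F [ y ])
    proj₁ (isSingleton-sem ρ x) (ne , minimal) with proj₁ (nonEmpty-sem ρ x) ne
    ... | e , e∈ with minimal [ e ] (lift (∈⇒singleton-⊆ e∈))
    ... | inj₁ (lift s) = e , s , ∈⇒singleton-⊆ e∈
    ... | inj₂ empty = ⊥-elim (¬Any[] (proj₁ (isEmpty-sem ([ e ] ∷ᵥ ρ) zero) empty (here refl)))
    proj₂ (isSingleton-sem ρ x) (y , ρx⊆ , ⊆ρx) = proj₂ (nonEmpty-sem ρ x) (y , ⊆ρx (here refl)) , minimal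
      where
        minimal : ∀ d → ⟦ W B ⟧ (var zero ⊆' var (suc x) ⇒' var (suc x) ⊆' var zero ∨' IsEmpty zero)
                                (d ∷ᵥ ρ)
        minimal [] _ = inj₂ (proj₂ (isEmpty-sem ([] ∷ᵥ ρ) zero) (λ ()))
        minimal (e ∷ d) (lift d⊆ρx) with singleton⁻ (ρx⊆ (d⊆ρx (here refl)))
        ... | refl = inj₁ (lift (⊆-trans ρx⊆ (∈⇒singleton-⊆ (here refl))))

    isLeast-sem : ∀ {k} (ρ : Fin k → FinSet) x {y} → ρ x ≈F [ y ] → ⟦ W B ⟧ (IsLeast x) ρ ⇔ (y ≡ 0I)
    proj₁ (isLeast-sem ρ x {y} e) noneBelow with compare 0I y
    ... | tri< 0<y _ _ = ⊥-elim (lower (noneBelow [ 0I ]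
                            (proj₂ (isSingleton-sem ([ 0I ] ∷ᵥ ρ) zero) (0I , ≈F-refl))
                            (lift (proj₂ (singleton-∃<⇔< ≈F-refl e) 0<y))))
    ... | tri≈ _ 0≡y _ = sym 0≡y
    ... | tri> _ _ y<0 = ⊥-elim (least y y<0)
    proj₂ (isLeast-sem ρ x e) refl _ _ (lift (i , _ , _ , j∈ , i<j)) =
      lift (least i (subst (i <_) (singleton⁻ (proj₁ e j∈)) i<j))

    ∀-singleton-sem : ∀ {k} (G φ : Fm (MOsig m) (suc k)) {ρ} {Q P : I → Set} →
      (∀ d → ⟦ W B ⟧ G (d ∷ᵥ ρ) ⇔ Σ I (λ y → d ≈F [ y ] × Q y)) →
      (∀ {d y} → d ≈F [ y ] → Q y → ⟦ W B ⟧ φ (d ∷ᵥ ρ) ⇔ P y) →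
      ⟦ W B ⟧ (∀' (G ⇒' φ)) ρ ⇔ (∀ y → Q y → P y)
    proj₁ (∀-singleton-sem G φ G-sem φ-sem) F y q =
      proj₁ (φ-sem ≈F-refl q) (F [ y ] (proj₂ (G-sem [ y ]) (y , ≈F-refl , q)))
    proj₂ (∀-singleton-sem G φ G-sem φ-sem) F d Gd with proj₁ (G-sem d) Gd
    ... | y , d≈y , q = proj₂ (φ-sem d≈y q) (F y q)

    ∃-singleton-sem : ∀ {k} (G φ : Fm (MOsig m) (suc k)) {ρ} {Q P : I → Set} →
      (∀ d → ⟦ W B ⟧ G (d ∷ᵥ ρ) ⇔ Σ I (λ y → d ≈F [ y ] × Q y)) →
      (∀ {d y} → d ≈F [ y ] → Q y → ⟦ W B ⟧ φ (d ∷ᵥ ρ) ⇔ P y) →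
      ⟦ W B ⟧ (∃' (G ∧' φ)) ρ ⇔ Σ I (λ y → Q y × P y)
    proj₁ (∃-singleton-sem G φ G-sem φ-sem) (d , Gd , φd) with proj₁ (G-sem d) Gd
    ... | y , d≈y , q = y , q , proj₁ (φ-sem d≈y q) φd
    proj₂ (∃-singleton-sem G φ G-sem φ-sem) (y , q , p) =
      [ y ] , proj₂ (G-sem [ y ]) (y , ≈F-refl , q) , proj₂ (φ-sem ≈F-refl q) p

    elementOf-sem : ∀ {k} (ρ : Fin k → FinSet) u d →
                    ⟦ W B ⟧ (ElementOf u) (d ∷ᵥ ρ) ⇔ Σ I (λ y → d ≈F [ y ] × y ∈ ρ u)
    proj₁ (elementOf-sem ρ u d) (single , lift d⊆) with proj₁ (isSingleton-sem (d ∷ᵥ ρ) zero) single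
    ... | y , d≈y = y , d≈y , proj₁ (singleton-⊆⇔∈ d≈y) d⊆
    proj₂ (elementOf-sem ρ u d) (y , d≈y , y∈) =
      proj₂ (isSingleton-sem (d ∷ᵥ ρ) zero) (y , d≈y) , lift (proj₂ (singleton-⊆⇔∈ d≈y) y∈)

    isZero-sem : ∀ {k} (ρ : Fin k → FinSet) x → ⟦ W B ⟧ (IsZero x) ρ ⇔ (ρ x ≈F [ 0I ])
    proj₁ (isZero-sem ρ x) (single , isLeast) with proj₁ (isSingleton-sem ρ x) single
    ... | y , e = subst (λ z → ρ x ≈F [ z ]) (proj₁ (isLeast-sem ρ x e) isLeast) e
    proj₂ (isZero-sem ρ x) e = proj₂ (isSingleton-sem ρ x) (0I , e) , proj₂ (isLeast-sem ρ x e) refl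

  module _ {n} (A : Fin n → FinSet) where

    algebra-isTop-sem : ∀ {k} (ρ : Fin k → I → Set) x →
                        ⟦ W⟨ A ⟩ ⟧ (IsTop x) ρ ⇔ (∀ i → i ∈⟨ A ⟩ → ρ x i)
    proj₁ (algebra-isTop-sem ρ x) F i i∈ = lower (F (λ _ → U.⊤)) i i∈ _
    proj₂ (algebra-isTop-sem ρ x) all _ = lift (λ i i∈ _ → all i i∈)

    algebra-nonEmpty-sem : ExcludedMiddle 0ℓ → ∀ {k} (ρ : Fin k → I → Set) x →
                           ⟦ W⟨ A ⟩ ⟧ (NonEmpty x) ρ ⇔ Σ I (λ i → i ∈⟨ A ⟩ × ρ x i)
    proj₁ (algebra-nonEmpty-sem em ρ x) (_ , ρx⊈Z) with em {Σ I (λ i → i ∈⟨ A ⟩ × ρ x i)}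
    ... | yes p = p
    ... | no ¬p = ⊥-elim (lower (ρx⊈Z (lift (λ i i∈ ρxi → ⊥-elim (¬p (i , i∈ , ρxi))))))
    proj₂ (algebra-nonEmpty-sem em ρ x) (i , i∈ , ρxi) = (λ _ → ⊥) , λ (lift s) → lift (s i i∈ ρxi)

  module _ {n} (A : Fin n → FinSet) (h : I → FinSet → FinSet) (iso : IsoFamily A h) where
    open IsWIso
    open WFormulas A

    ∈⟨⟩list⇔∈⟨⟩ : ∀ {i} → (i ∈ ⟨ A ⟩list) ⇔ (i ∈⟨ A ⟩)
    proj₁ ∈⟨⟩list⇔∈⟨⟩ (here refl) = inj₁ refl
    proj₁ ∈⟨⟩list⇔∈⟨⟩ (there i∈) with find (∈-concatMap⁻ A {xs = allFin n} i∈)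
    ... | c , _ , i∈Ac = inj₂ (c , i∈Ac)
    proj₂ ∈⟨⟩list⇔∈⟨⟩ (inj₁ refl) = here refl
    proj₂ ∈⟨⟩list⇔∈⟨⟩ (inj₂ (c , i∈Ac)) =
      there (∈-concatMap⁺ A {xs = allFin n} (lose (∈-allFin c) i∈Ac))

    ∈-g⇔ : ∀ f {y} → (y ∈ g A h f) ⇔ Σ I (λ i → i ∈⟨ A ⟩ × y ∈ h i (f i))
    proj₁ (∈-g⇔ f) y∈ with find (∈-concatMap⁻ (λ i → h i (f i)) {xs = ⟨ A ⟩list} y∈)
    ... | i , i∈ , y∈hi = i , proj₁ ∈⟨⟩list⇔∈⟨⟩ i∈ , y∈hi
    proj₂ (∈-g⇔ f) (i , i∈ , y∈hi) =
      ∈-concatMap⁺ (λ i → h i (f i)) {xs = ⟨ A ⟩list} (lose (proj₂ ∈⟨⟩list⇔∈⟨⟩ i∈) y∈hi)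

    successorInterval-unique : ∀ {i j y} → i ∈⟨ A ⟩ → j ∈⟨ A ⟩ →
                               InSuccInterval A i y → InSuccInterval A j y → i ≡ j
    successorInterval-unique {i} {j} i∈ j∈ (i≤y , y<⁺i) (j≤y , y<⁺j) with compare i j
    ... | tri< i<j _ _ = ⊥-elim (≤⇒≯ j≤y (y<⁺i j j∈ i<j))
    ... | tri≈ _ i≡j _ = i≡j
    ... | tri> _ _ j<i = ⊥-elim (≤⇒≯ i≤y (y<⁺j i i∈ j<i))

    ∈-g⇔∈-h : ∀ f {i y} → i ∈⟨ A ⟩ → InSuccInterval A i y → (y ∈ g A h f) ⇔ (y ∈ h i (f i))
    proj₁ (∈-g⇔∈-h f i∈ y∈I) y∈ with proj₁ (∈-g⇔ f) y∈
    ... | j , j∈ , y∈hj with successorInterval-unique i∈ j∈ y∈I (into (iso _ j∈) (f j) _ y∈hj)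
    ... | refl = y∈hj
    proj₂ (∈-g⇔∈-h f i∈ _) y∈hi = proj₂ (∈-g⇔ f) (_ , i∈ , y∈hi)

    g-⊆⇔ : ∀ f f′ → (∀ i → i ∈⟨ A ⟩ → f i ⊆ f′ i) ⇔ (g A h f ⊆ g A h f′)
    proj₁ (g-⊆⇔ f f′) f⊆f′ y∈ with proj₁ (∈-g⇔ f) y∈
    ... | i , i∈ , y∈hi =
      proj₂ (∈-g⇔ f′) (i , i∈ , proj₁ (pres-⊆ (iso i i∈) (f i) (f′ i)) (f⊆f′ i i∈) y∈hi)
    proj₂ (g-⊆⇔ f f′) gf⊆gf′ i i∈ = proj₂ (pres-⊆ (iso i i∈) (f i) (f′ i)) λ y∈hi →
      let y∈I = into (iso i i∈) (f i) _ y∈hi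
      in proj₁ (∈-g⇔∈-h f′ i∈ y∈I) (gf⊆gf′ (proj₂ (∈-g⇔∈-h f i∈ y∈I) y∈hi))

    g-≈F⇔ : ∀ f f′ → (∀ i → i ∈⟨ A ⟩ → f i ≈F f′ i) ⇔ (g A h f ≈F g A h f′)
    proj₁ (g-≈F⇔ f f′) f≈f′ =
      proj₁ (g-⊆⇔ f f′) (λ i → proj₁ ∘ f≈f′ i) , proj₁ (g-⊆⇔ f′ f) (λ i → proj₂ ∘ f≈f′ i)
    proj₂ (g-≈F⇔ f f′) (gf⊆gf′ , gf′⊆gf) i i∈ =
      proj₂ (g-⊆⇔ f f′) gf⊆gf′ i i∈ , proj₂ (g-⊆⇔ f′ f) gf′⊆gf i i∈

    h-[] : ∀ {i} → i ∈⟨ A ⟩ → h i [] ⊆ []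
    h-[] i∈ with onto (iso _ i∈) [] All.[]
    ... | C , hC≈[] = ⊆-trans (proj₁ (pres-⊆ (iso _ i∈) [] C) (λ ())) (proj₁ hC≈[])

    h-nonEmpty⇔ : ∀ {i} → i ∈⟨ A ⟩ → ∀ B → Σ I (_∈ h i B) ⇔ Σ I (_∈ B)
    proj₁ (h-nonEmpty⇔ i∈ B) (_ , y∈) =
      ⊈⇒element {z = []} (λ B⊆[] → ¬Any[] (h-[] i∈ (proj₁ (pres-⊆ (iso _ i∈) B []) B⊆[] y∈)))
    proj₂ (h-nonEmpty⇔ i∈ B) (_ , b∈) =
      ⊈⇒element {z = []} λ hB⊆[] →
        ¬Any[] (proj₂ (pres-⊆ (iso _ i∈) B []) (⊆-trans hB⊆[] (λ ())) b∈)

    h-zero : ∀ {i B} → i ∈⟨ A ⟩ → B ≈F [ 0I ] → h i B ≈F [ i ]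
    h-zero {i} {B} i∈ B≈0 with onto (iso i i∈) [ i ] ((inj₁ refl , λ _ _ i<a → i<a) All.∷ All.[])
    ... | D , hD≈i =
      ≈F-trans (proj₁ (pres-⊆ hᵢ B D) (proj₁ B≈D) , proj₁ (pres-⊆ hᵢ D B) (proj₂ B≈D)) hD≈i
      where
        hᵢ = iso i i∈
        D⊆0 : ∀ {x} → x ∈ D → x ≡ 0I
        D⊆0 {x} x∈ with compare 0I x
        ... | tri< 0<x _ _ with proj₁ (pres-∃< hᵢ B D) (0I , x , proj₂ B≈0 (here refl) , x∈ , 0<x)
        ...   | u , _ , u∈ , v∈ , u<v with singleton⁻ (proj₁ hD≈i v∈)
        ...     | refl = ⊥-elim (≤⇒≯ (proj₁ (into hᵢ B u u∈)) u<v)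
        D⊆0 x∈ | tri≈ _ 0≡x _ = sym 0≡x
        D⊆0 x∈ | tri> _ _ x<0 = ⊥-elim (least _ x<0)
        B≈D : B ≈F D
        B≈D = ≈F-trans B≈0 (≈F-sym (constant⇒≈F-singleton
                (proj₁ (h-nonEmpty⇔ i∈ D) (i , proj₂ hD≈i (here refl))) D⊆0))

    g-∃<⇔ : ∀ f f′ → (g A h f ∃< g A h f′) ⇔
      (Σ I (λ i → Σ I λ j → i ∈⟨ A ⟩ × j ∈⟨ A ⟩ × Σ I (_∈ f i) × Σ I (_∈ f′ j) × i < j)
       ⊎ Σ I (λ i → i ∈⟨ A ⟩ × f i ∃< f′ i))
    proj₁ (g-∃<⇔ f f′) (y , z , y∈ , z∈ , y<z) with proj₁ (∈-g⇔ f) y∈ | proj₁ (∈-g⇔ f′) z∈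
    ... | i , i∈ , y∈hi | j , j∈ , z∈hj with compare i j
    ... | tri< i<j _ _ = inj₁ (i , j , i∈ , j∈ , proj₁ (h-nonEmpty⇔ i∈ (f i)) (y , y∈hi) ,
                               proj₁ (h-nonEmpty⇔ j∈ (f′ j)) (z , z∈hj) , i<j)
    ... | tri≈ _ refl _ =
      inj₂ (i , i∈ , proj₂ (pres-∃< (iso i i∈) (f i) (f′ i)) (y , z , y∈hi , z∈hj , y<z))
    ... | tri> _ _ j<i = ⊥-elim (≤⇒≯ (proj₁ (into (iso i i∈) _ y y∈hi))
                                     (<-trans y<z (proj₂ (into (iso j j∈) _ z z∈hj) i i∈ j<i)))
    proj₂ (g-∃<⇔ f f′) (inj₁ (i , j , i∈ , j∈ , fi≠∅ , f′j≠∅ , i<j))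
      with proj₂ (h-nonEmpty⇔ i∈ (f i)) fi≠∅ | proj₂ (h-nonEmpty⇔ j∈ (f′ j)) f′j≠∅
    ... | y , y∈hi | z , z∈hj =
      y , z , proj₂ (∈-g⇔ f) (i , i∈ , y∈hi) , proj₂ (∈-g⇔ f′) (j , j∈ , z∈hj) ,
      <-≤-trans (proj₂ (into (iso i i∈) _ y y∈hi) j j∈ i<j) (proj₁ (into (iso j j∈) _ z z∈hj))
    proj₂ (g-∃<⇔ f f′) (inj₂ (i , i∈ , fi∃<f′i))
      with proj₁ (pres-∃< (iso i i∈) (f i) (f′ i)) fi∃<f′i
    ... | y , z , y∈hi , z∈hi , y<z =
      y , z , proj₂ (∈-g⇔ f) (i , i∈ , y∈hi) , proj₂ (∈-g⇔ f′) (i , i∈ , z∈hi) , y<z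

    isPoint-sem : ∀ {k} (ρ : Fin k → FinSet) x →
                  ⟦ W A ⟧ (IsPoint x) ρ ⇔ Σ I (λ y → ρ x ≈F [ y ] × y ∈⟨ A ⟩)
    isPoint-sem ρ x =
      (λ (single , kind) → let (y , e) = proj₁ (isSingleton-sem ρ x) single in y , e , proj₁ (kind-sem e) kind) ,
      (λ (y , e , y∈) → proj₂ (isSingleton-sem ρ x) (y , e) , proj₂ (kind-sem e) y∈)
      where
        kind-sem : ∀ {y} → ρ x ≈F [ y ] →
                   ⟦ W A ⟧ (IsLeast x ∨' ⋁ (λ c → var x ⊆' con c)) ρ ⇔ (y ∈⟨ A ⟩)
        kind-sem e = ⊎-cong-⇔ (isLeast-sem ρ x e)
                              (⇔-trans (⋁-sem (W A) _ ρ) (Σ-cong-⇔ (λ _ → Lift-⇔ (singleton-⊆⇔∈ e))))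

    inInterval-sem : ∀ {k} (ρ : Fin k → FinSet) a b {i y} → ρ a ≈F [ i ] → ρ b ≈F [ y ] →
                     ⟦ W A ⟧ (InInterval a b) ρ ⇔ InSuccInterval A i y
    inInterval-sem ρ a b ea eb =
      ×-cong-⇔ (⊎-cong-⇔ (Lift-⇔ (singleton-≈F⇔≡ ea eb)) (Lift-⇔ (singleton-∃<⇔< ea eb)))
               (∀-singleton-sem (IsPoint zero) (var (suc a) ∃<' var zero ⇒' var (suc b) ∃<' var zero)
                  (λ d → isPoint-sem (d ∷ᵥ ρ) zero)
                  λ d≈c _ → →-cong-⇔ (Lift-⇔ (singleton-∃<⇔< ea d≈c)) (Lift-⇔ (singleton-∃<⇔< eb d≈c)))

    insideInterval-sem : ∀ {k} (ρ : Fin k → FinSet) a u {i} → ρ a ≈F [ i ] →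
                         ⟦ W A ⟧ (InsideInterval a u) ρ ⇔ (∀ y → y ∈ ρ u → InSuccInterval A i y)
    insideInterval-sem ρ a u ea =
      ∀-singleton-sem (ElementOf u) (InInterval (suc a) zero) (elementOf-sem ρ u)
        λ d≈y _ → inInterval-sem _ (suc a) zero ea d≈y

    onlyPoints-sem : ∀ {k} (ρ : Fin k → FinSet) u →
                     ⟦ W A ⟧ (OnlyPoints u) ρ ⇔ (∀ y → y ∈ ρ u → y ∈⟨ A ⟩)
    onlyPoints-sem ρ u = ∀-singleton-sem (ElementOf u) (IsPoint zero) (elementOf-sem ρ u) λ {d} d≈y _ →
      (λ pt → let (_ , d≈y′ , y′∈) = proj₁ (isPoint-sem (d ∷ᵥ ρ) zero) pt
              in subst (_∈⟨ A ⟩) (proj₁ (singleton-≈F⇔≡ d≈y′ d≈y) ≈F-refl) y′∈) ,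
      (λ y∈ → proj₂ (isPoint-sem (d ∷ᵥ ρ) zero) (_ , d≈y , y∈))

    Represents : I → FinSet → FinSet → Set
    Represents i u B = ∀ y → InSuccInterval A i y → (y ∈ u) ⇔ (y ∈ h i B)

    represented-⊆⇔ : ∀ {i u v B C} → i ∈⟨ A ⟩ → Represents i u B → Represents i v C →
                     (∀ y → y ∈ u → InSuccInterval A i y → y ∈ v) ⇔ (h i B ⊆ h i C)
    proj₁ (represented-⊆⇔ {B = B} i∈ repB repC) F {y} y∈hB =
      let y∈I = into (iso _ i∈) B y y∈hB in proj₁ (repC y y∈I) (F y (proj₂ (repB y y∈I) y∈hB) y∈I)
    proj₂ (represented-⊆⇔ i∈ repB repC) hB⊆hC y y∈u y∈I =
      proj₂ (repC y y∈I) (hB⊆hC (proj₁ (repB y y∈I) y∈u))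

    represented-∃<⇔ : ∀ {i u v B C} → i ∈⟨ A ⟩ → Represents i u B → Represents i v C →
      Σ I (λ y → y ∈ u × InSuccInterval A i y × Σ I (λ z → z ∈ v × InSuccInterval A i z × y < z))
      ⇔ (h i B ∃< h i C)
    proj₁ (represented-∃<⇔ i∈ repB repC) (y , y∈u , y∈I , z , z∈v , z∈I , y<z) =
      y , z , proj₁ (repB y y∈I) y∈u , proj₁ (repC z z∈I) z∈v , y<z
    proj₂ (represented-∃<⇔ {B = B} {C} i∈ repB repC) (y , z , y∈hB , z∈hC , y<z) =
      y , proj₂ (repB y y∈I) y∈hB , y∈I , z , proj₂ (repC z z∈I) z∈hC , z∈I , y<z
      where y∈I = into (iso _ i∈) B y y∈hB
            z∈I = into (iso _ i∈) C z z∈hC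

    subsetOn-sem : ∀ {k} (ρ : Fin k → FinSet) a s t {i B C} → i ∈⟨ A ⟩ → ρ a ≈F [ i ] →
                   Represents i (ρ s) B → Represents i (ρ t) C → ⟦ W A ⟧ (SubsetOn a s t) ρ ⇔ (B ⊆ C)
    subsetOn-sem ρ a s t i∈ ea repB repC =
      ⇔-trans (∀-singleton-sem (ElementOf s) (InInterval (suc a) zero ⇒' var zero ⊆' var (suc t))
                 (elementOf-sem ρ s)
                 λ d≈y _ → →-cong-⇔ (inInterval-sem _ (suc a) zero ea d≈y)
                                    (Lift-⇔ (singleton-⊆⇔∈ d≈y)))
      (⇔-trans (represented-⊆⇔ i∈ repB repC) (⇔-sym (pres-⊆ (iso _ i∈) _ _)))

    existsLessOn-sem : ∀ {k} (ρ : Fin k → FinSet) a s t {i B C} → i ∈⟨ A ⟩ → ρ a ≈F [ i ] →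
                       Represents i (ρ s) B → Represents i (ρ t) C →
                       ⟦ W A ⟧ (ExistsLessOn a s t) ρ ⇔ (B ∃< C)
    existsLessOn-sem ρ a s t i∈ ea repB repC =
      ⇔-trans (∃-singleton-sem (ElementOf s)
                 (InInterval (suc a) zero ∧'
                  ∃' (ElementOf (suc t) ∧' InInterval (suc (suc a)) zero ∧' var (suc zero) ∃<' var zero))
                 (elementOf-sem ρ s) λ {d} d≈y _ →
                 ×-cong-⇔ (inInterval-sem (d ∷ᵥ ρ) (suc a) zero ea d≈y)
                   (∃-singleton-sem (ElementOf (suc t))
                      (InInterval (suc (suc a)) zero ∧' var (suc zero) ∃<' var zero)
                      (elementOf-sem (d ∷ᵥ ρ) (suc t))
                      λ {d′} d′≈z _ →
                        ×-cong-⇔ (inInterval-sem (d′ ∷ᵥ d ∷ᵥ ρ) (suc (suc a)) zero ea d′≈z)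
                                          (Lift-⇔ (singleton-∃<⇔< d≈y d′≈z))))
      (⇔-trans (represented-∃<⇔ i∈ repB repC) (⇔-sym (pres-∃< (iso _ i∈) _ _)))

    represents-∷ : ∀ {p q i} {σ : Fin p → Fin q} {ρ : Fin p → FinSet} {ρ′ : Fin q → FinSet} {u d} →
                   (∀ x → Represents i (ρ′ (σ x)) (ρ x)) →
                   Represents i u d → ∀ x → Represents i ((u ∷ᵥ ρ′) (Fin.lift 1 σ x)) ((d ∷ᵥ ρ) x)
    represents-∷ reps rep zero = rep
    represents-∷ reps rep (suc x) = reps x

    represents-term : ∀ {p q i} {σ : Fin p → Fin q} {ρ : Fin p → FinSet} {ρ′ : Fin q → FinSet} →
                      (∀ x → Represents i (ρ′ (σ x)) (ρ x)) →
                      (t : Term LMO p) → Represents i (ρ′ (σ (varOfLMO t))) (evalT W𝕀 ρ t)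
    represents-term reps (var x) = reps x

    inside⇒represented : ∀ {i u} → i ∈⟨ A ⟩ → (∀ y → y ∈ u → InSuccInterval A i y) →
                         Σ FinSet (Represents i u)
    inside⇒represented i∈ inside with onto (iso _ i∈) _ (All.tabulate (inside _))
    ... | B , hB≈u = B , λ _ _ → proj₂ hB≈u , proj₁ hB≈u

    relativise-sem : ∀ {p q} (θ : Fm LMO p) (σ : Fin p → Fin q) a {i} → i ∈⟨ A ⟩ →
      {ρ : Fin p → FinSet} {ρ′ : Fin q → FinSet} → ρ′ a ≈F [ i ] →
      (∀ x → Represents i (ρ′ (σ x)) (ρ x)) → ⟦ W𝕀 ⟧ θ ρ ⇔ ⟦ W A ⟧ (relativise θ σ a) ρ′
    relativise-sem (rel ⊆R ts) σ a i∈ {ρ′ = ρ′} ea reps = Lift-⇔ (⇔-sym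
      (subsetOn-sem ρ′ a _ _ i∈ ea (term (ts zero)) (term (ts (suc zero)))))
      where term = represents-term {σ = σ} {ρ′ = ρ′} reps
    relativise-sem (rel ∃<R ts) σ a i∈ {ρ′ = ρ′} ea reps = Lift-⇔ (⇔-sym
      (existsLessOn-sem ρ′ a _ _ i∈ ea (term (ts zero)) (term (ts (suc zero)))))
      where term = represents-term {σ = σ} {ρ′ = ρ′} reps
    relativise-sem (s ≐ t) σ a i∈ {ρ′ = ρ′} ea reps = Lift-⇔ (×-cong-⇔
      (⇔-sym (subsetOn-sem ρ′ a _ _ i∈ ea (term s) (term t)))
      (⇔-sym (subsetOn-sem ρ′ a _ _ i∈ ea (term t) (term s))))
      where term = represents-term {σ = σ} {ρ′ = ρ′} reps
    relativise-sem ⊤' σ a i∈ ea reps = ⊤-cong-⇔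
    relativise-sem ⊥' σ a i∈ ea reps = ⊥-cong-⇔
    relativise-sem (¬' φ) σ a i∈ ea reps = ¬-cong-⇔ (relativise-sem φ σ a i∈ ea reps)
    relativise-sem (φ ∧' ψ) σ a i∈ ea reps =
      ×-cong-⇔ (relativise-sem φ σ a i∈ ea reps) (relativise-sem ψ σ a i∈ ea reps)
    relativise-sem (φ ∨' ψ) σ a i∈ ea reps =
      ⊎-cong-⇔ (relativise-sem φ σ a i∈ ea reps) (relativise-sem ψ σ a i∈ ea reps)
    relativise-sem (φ ⇒' ψ) σ a i∈ ea reps =
      →-cong-⇔ (relativise-sem φ σ a i∈ ea reps) (relativise-sem ψ σ a i∈ ea reps)
    relativise-sem (∀' φ) σ a {i} i∈ {ρ} {ρ′} ea reps = forward , backward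
      where
        IH : ∀ {u d} → Represents i u d → _
        IH rep = relativise-sem φ (Fin.lift 1 σ) (suc a) i∈ ea (represents-∷ reps rep)
        inside-sem = λ u → insideInterval-sem (u ∷ᵥ ρ′) (suc a) zero ea
        forward : ⟦ W𝕀 ⟧ (∀' φ) ρ → ⟦ W A ⟧ (relativise (∀' φ) σ a) ρ′
        forward F u inside with inside⇒represented i∈ (proj₁ (inside-sem u) inside)
        ... | d , rep = proj₁ (IH rep) (F d)
        backward : ⟦ W A ⟧ (relativise (∀' φ) σ a) ρ′ → ⟦ W𝕀 ⟧ (∀' φ) ρ
        backward G d =
          proj₂ (IH {d = d} (λ _ _ → ⇔-refl)) (G (h i d) (proj₂ (inside-sem (h i d)) (into (iso i i∈) d)))
    relativise-sem (∃' φ) σ a {i} i∈ {ρ} {ρ′} ea reps = forward , backward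
      where
        IH : ∀ {u d} → Represents i u d → _
        IH rep = relativise-sem φ (Fin.lift 1 σ) (suc a) i∈ ea (represents-∷ reps rep)
        inside-sem = λ u → insideInterval-sem (u ∷ᵥ ρ′) (suc a) zero ea
        forward : ⟦ W𝕀 ⟧ (∃' φ) ρ → ⟦ W A ⟧ (relativise (∃' φ) σ a) ρ′
        forward (d , φd) =
          h i d , proj₂ (inside-sem (h i d)) (into (iso i i∈) d) , proj₁ (IH {d = d} (λ _ _ → ⇔-refl)) φd
        backward : ⟦ W A ⟧ (relativise (∃' φ) σ a) ρ′ → ⟦ W𝕀 ⟧ (∃' φ) ρ
        backward (u , inside , φu) with inside⇒represented i∈ (proj₁ (inside-sem u) inside)
        ... | d , rep = d , proj₂ (IH rep) φu

    Defines : ∀ {m q} → (Fin m → Fm (MOsig n) (suc q)) → (Fin m → I → Set) → (Fin q → FinSet) → Set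
    Defines mem Y ρ′ = ∀ v {b i} → b ≈F [ i ] → i ∈⟨ A ⟩ → Y v i ⇔ ⟦ W A ⟧ (mem v) (b ∷ᵥ ρ′)

    memberOf-sem : ∀ {m q} {mem : Fin m → Fm (MOsig n) (suc q)} {Y ρ′} → Defines mem Y ρ′ →
                   ∀ t {b i} → b ≈F [ i ] → i ∈⟨ A ⟩ →
                   evalT W⟨ A ⟩ Y t i ⇔ ⟦ W A ⟧ (memberOf mem t) (b ∷ᵥ ρ′)
    memberOf-sem def (var v) = def v
    memberOf-sem def (con c) b≈i _ = ⇔-sym (Lift-⇔ (singleton-⊆⇔∈ b≈i))

    defines-∷ : ∀ {m q} {mem : Fin m → Fm (MOsig n) (suc q)} {Y ρ′ S z} → Defines mem Y ρ′ →
                (∀ i → i ∈⟨ A ⟩ → S i ⇔ (i ∈ z)) → Defines (extendMember mem) (S ∷ᵥ Y) (z ∷ᵥ ρ′)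
    defines-∷ def S≡z zero b≈i i∈ = ⇔-trans (S≡z _ i∈) (⇔-sym (Lift-⇔ (singleton-⊆⇔∈ b≈i)))
    defines-∷ {mem = mem} {ρ′ = ρ′} {z = z} def S≡z (suc v) {b} b≈i i∈ =
      ⇔-trans (def v b≈i i∈) (⇔-sym (weakenUnder-sem (mem v) b z ρ′))

    module _ (em : ExcludedMiddle 0ℓ) where

      pointCode : (S : I → Set) →
                  Σ FinSet λ z → (∀ y → y ∈ z → y ∈⟨ A ⟩) × (∀ i → i ∈⟨ A ⟩ → S i ⇔ (i ∈ z))
      pointCode S = filter S? ⟨ A ⟩list ,
        (λ _ y∈ → proj₁ ∈⟨⟩list⇔∈⟨⟩ (proj₁ (∈-filter⁻ S? y∈))) ,
        (λ _ i∈ → ∈-filter⁺ S? (proj₂ ∈⟨⟩list⇔∈⟨⟩ i∈) , proj₂ ∘ ∈-filter⁻ S?)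
        where S? = λ _ → em

      onPoints-sem : ∀ {m q} (φ : Fm (MOsig n) m) (mem : Fin m → Fm (MOsig n) (suc q)) {Y ρ′} →
                     Defines mem Y ρ′ → ⟦ W⟨ A ⟩ ⟧ φ Y ⇔ ⟦ W A ⟧ (onPoints φ mem) ρ′
      onPoints-sem (rel ⊆R ts) mem {ρ′ = ρ′} def = Lift-⇔ (⇔-sym
        (∀-singleton-sem (IsPoint zero) (memberOf mem (ts zero) ⇒' memberOf mem (ts (suc zero)))
           (λ d → isPoint-sem (d ∷ᵥ ρ′) zero)
           λ b≈i i∈ → ⇔-sym (→-cong-⇔ (memberOf-sem def (ts zero) b≈i i∈)
                                      (memberOf-sem def (ts (suc zero)) b≈i i∈))))
      onPoints-sem (rel ∃<R ts) mem {ρ′ = ρ′} def = Lift-⇔ (⇔-sym (⇔-trans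
        (∃-singleton-sem (IsPoint zero)
           (memberOf mem (ts zero) ∧'
            ∃' (IsPoint zero ∧' rename (Fin.lift 1 suc) (memberOf mem (ts (suc zero))) ∧'
                var (suc zero) ∃<' var zero))
           (λ d → isPoint-sem (d ∷ᵥ ρ′) zero) λ {d} b≈i i∈ →
          ×-cong-⇔ (⇔-sym (memberOf-sem def (ts zero) b≈i i∈))
            (∃-singleton-sem (IsPoint zero)
               (rename (Fin.lift 1 suc) (memberOf mem (ts (suc zero))) ∧' var (suc zero) ∃<' var zero)
               (λ d′ → isPoint-sem (d′ ∷ᵥ d ∷ᵥ ρ′) zero) λ {d′} b′≈j j∈ →
              ×-cong-⇔ (⇔-trans (weakenUnder-sem (memberOf mem (ts (suc zero))) d′ d ρ′)
                                (⇔-sym (memberOf-sem def (ts (suc zero)) b′≈j j∈)))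
                       (Lift-⇔ (singleton-∃<⇔< b≈i b′≈j))))
        ((λ (i , i∈ , p , j , j∈ , q , i<j) → i , j , i∈ , j∈ , p , q , i<j) ,
         (λ (i , j , i∈ , j∈ , p , q , i<j) → i , i∈ , p , j , j∈ , q , i<j))))
      onPoints-sem (s ≐ t) mem {ρ′ = ρ′} def = Lift-⇔ (⇔-sym (⇔-trans
        (∀-singleton-sem (IsPoint zero) ((memberOf mem s ⇒' memberOf mem t) ∧' (memberOf mem t ⇒' memberOf mem s))
           (λ d → isPoint-sem (d ∷ᵥ ρ′) zero) λ b≈i i∈ →
          let s-sem = memberOf-sem def s b≈i i∈ ; t-sem = memberOf-sem def t b≈i i∈
          in ⇔-sym (×-cong-⇔ (→-cong-⇔ s-sem t-sem) (→-cong-⇔ t-sem s-sem)))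
        ((λ F → (λ i i∈ → proj₁ (F i i∈)) , (λ i i∈ → proj₂ (F i i∈))) ,
         (λ (F , G) i i∈ → F i i∈ , G i i∈))))
      onPoints-sem ⊤' mem def = ⊤-cong-⇔
      onPoints-sem ⊥' mem def = ⊥-cong-⇔
      onPoints-sem (¬' φ) mem def = ¬-cong-⇔ (onPoints-sem φ mem def)
      onPoints-sem (φ ∧' ψ) mem def = ×-cong-⇔ (onPoints-sem φ mem def) (onPoints-sem ψ mem def)
      onPoints-sem (φ ∨' ψ) mem def = ⊎-cong-⇔ (onPoints-sem φ mem def) (onPoints-sem ψ mem def)
      onPoints-sem (φ ⇒' ψ) mem def = →-cong-⇔ (onPoints-sem φ mem def) (onPoints-sem ψ mem def)
      onPoints-sem (∀' φ) mem {Y} {ρ′} def = forward , backward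
        where
          IH : ∀ {S z} → (∀ i → i ∈⟨ A ⟩ → S i ⇔ (i ∈ z)) → _
          IH S≡z = onPoints-sem φ (extendMember mem) (defines-∷ def S≡z)
          forward : ⟦ W⟨ A ⟩ ⟧ (∀' φ) Y → ⟦ W A ⟧ (onPoints (∀' φ) mem) ρ′
          forward F z _ = proj₁ (IH {S = _∈ z} (λ _ _ → ⇔-refl)) (F (_∈ z))
          backward : ⟦ W A ⟧ (onPoints (∀' φ) mem) ρ′ → ⟦ W⟨ A ⟩ ⟧ (∀' φ) Y
          backward G S = let (z , z⊆⟨A⟩ , S≡z) = pointCode S
                         in proj₂ (IH S≡z) (G z (proj₂ (onlyPoints-sem (z ∷ᵥ ρ′) zero) z⊆⟨A⟩))
      onPoints-sem (∃' φ) mem {Y} {ρ′} def = forward , backward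
        where
          IH : ∀ {S z} → (∀ i → i ∈⟨ A ⟩ → S i ⇔ (i ∈ z)) → _
          IH S≡z = onPoints-sem φ (extendMember mem) (defines-∷ def S≡z)
          forward : ⟦ W⟨ A ⟩ ⟧ (∃' φ) Y → ⟦ W A ⟧ (onPoints (∃' φ) mem) ρ′
          forward (S , φS) = let (z , z⊆⟨A⟩ , S≡z) = pointCode S
                             in z , proj₂ (onlyPoints-sem (z ∷ᵥ ρ′) zero) z⊆⟨A⟩ , proj₁ (IH S≡z) φS
          backward : ⟦ W A ⟧ (onPoints (∃' φ) mem) ρ′ → ⟦ W⟨ A ⟩ ⟧ (∃' φ) Y
          backward (z , _ , φz) = (_∈ z) , proj₂ (IH {S = _∈ z} (λ _ _ → ⇔-refl)) φz

      translateR-sem : ∀ {k p} (ζ : Acceptable n p) (ts : Fin p → Term (GPsig n) k) (fs : Fin k → I → FinSet) →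
                       ⟦ GP A ⟧ (rel ζ ts) fs ⇔ ⟦ W A ⟧ (translateR ζ ts) (g A h ∘ fs)
      translateR-sem ζ ts fs = Lift-⇔ (onPoints-sem Φ _ defines)
        where
          open Acceptable ζ
          defines : Defines (λ l → relativise (θ l) (suc ∘ varOfGP ∘ ts) zero)
                            (λ l → ‖ A ‖ (θ l) (λ x → evalT (GP A) fs (ts x))) (g A h ∘ fs)
          defines l {b} {i} b≈i i∈ = (λ (_ , p) → proj₁ θ-sem p) , (λ q → i∈ , proj₂ θ-sem q)
            where
              reps : ∀ x → Represents i ((b ∷ᵥ g A h ∘ fs) (suc (varOfGP (ts x)))) (evalT (GP A) fs (ts x) i)
              reps x with ts x
              ... | var y = λ _ y∈I → ∈-g⇔∈-h (fs y) i∈ y∈I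
              θ-sem = relativise-sem (θ l) (suc ∘ varOfGP ∘ ts) zero i∈ b≈i reps

      fromGP-sem : ∀ {k} {ψ : Fm (GPsig n) k} (atomic : IsAtomic ψ) (fs : Fin k → I → FinSet) →
                   ⟦ GP A ⟧ ψ fs ⇔ ⟦ W A ⟧ (fromGP atomic) (g A h ∘ fs)
      fromGP-sem (rel-atomic ζ ts) fs = translateR-sem ζ ts fs
      fromGP-sem (eq-atomic (var x) (var y)) fs = Lift-⇔ (Lift-⇔ (⇔-Lift (g-≈F⇔ (fs x) (fs y))))

      ζ-⊆-sem : ∀ (fs′ : Fin 2 → I → FinSet) →
                relI (GP A) ζ-⊆ fs′ ⇔ (g A h (fs′ zero) ⊆ g A h (fs′ (suc zero)))
      ζ-⊆-sem fs′ = ⇔-trans (algebra-isTop-sem A (λ l → ‖ A ‖ (Acceptable.θ (ζ-⊆ {n}) l) fs′) zero)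
                            (⇔-trans pointwise (g-⊆⇔ _ _))
        where
          pointwise : (∀ i → i ∈⟨ A ⟩ → ‖ A ‖ (var zero ⊆' var (suc zero)) fs′ i) ⇔
                      (∀ i → i ∈⟨ A ⟩ → fs′ zero i ⊆ fs′ (suc zero) i)
          pointwise = (λ F i i∈ → lower (proj₂ (F i i∈))) , (λ F i i∈ → i∈ , lift (F i i∈))

      ζ-∃<-sem : ∀ (fs′ : Fin 2 → I → FinSet) →
                 relI (GP A) ζ-∃< fs′ ⇔ (g A h (fs′ zero) ∃< g A h (fs′ (suc zero)))
      ζ-∃<-sem fs′ = ⇔-trans (⊎-cong-⇔ apart together) (⇔-sym (g-∃<⇔ _ _))
        where
          nonEmpty-at : ∀ x i → ⟦ W𝕀 ⟧ (NonEmpty x) (λ l → fs′ l i) ⇔ Σ I (_∈ fs′ x i)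
          nonEmpty-at x i = WFormulas.nonEmpty-sem (constI W𝕀) (λ l → fs′ l i) x
          Y = λ l → ‖ A ‖ (Acceptable.θ (ζ-∃< {n}) l) fs′
          apart : ⟦ W⟨ A ⟩ ⟧ (var (suc zero) ∃<' var (suc (suc zero))) Y ⇔
                  Σ I (λ i → Σ I λ j → i ∈⟨ A ⟩ × j ∈⟨ A ⟩ ×
                                       Σ I (_∈ fs′ zero i) × Σ I (_∈ fs′ (suc zero) j) × i < j)
          proj₁ apart (lift (i , j , i∈ , j∈ , (_ , ne) , (_ , ne′) , i<j)) =
            i , j , i∈ , j∈ , proj₁ (nonEmpty-at zero i) ne , proj₁ (nonEmpty-at (suc zero) j) ne′ , i<j
          proj₂ apart (i , j , i∈ , j∈ , ne , ne′ , i<j) =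
            lift (i , j , i∈ , j∈ , (i∈ , proj₂ (nonEmpty-at zero i) ne) ,
                  (j∈ , proj₂ (nonEmpty-at (suc zero) j) ne′) , i<j)
          together : ⟦ W⟨ A ⟩ ⟧ (NonEmpty zero) Y ⇔
                     Σ I (λ i → i ∈⟨ A ⟩ × fs′ zero i ∃< fs′ (suc zero) i)
          together = ⇔-trans (algebra-nonEmpty-sem A em Y zero)
                             (Σ-cong-⇔ λ _ → (λ (i∈ , _ , lift p) → i∈ , p) , (λ (i∈ , p) → i∈ , i∈ , lift p))

      Encodes : Fin n → (I → FinSet) → Set
      Encodes c f = ∀ i → i ∈⟨ A ⟩ → ((i ∈ A c) ⇔ (f i ≈F [ 0I ])) × ((f i ≈F [ 0I ]) ⊎ (f i ⊆ []))

      ζ-const-sem : ∀ c (fs′ : Fin 1 → I → FinSet) → relI (GP A) (ζ-const c) fs′ ⇔ Encodes c (fs′ zero)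
      ζ-const-sem c fs′ = forward , backward
        where
          Y = λ l → ‖ A ‖ (Acceptable.θ (ζ-const c) l) fs′
          zero-at = λ i → WFormulas.isZero-sem (constI W𝕀) (λ l → fs′ l i) zero
          empty-at = λ i → WFormulas.isEmpty-sem (constI W𝕀) (λ l → fs′ l i) zero
          top = algebra-isTop-sem A Y (suc zero)
          forward : relI (GP A) (ζ-const c) fs′ → Encodes c (fs′ zero)
          forward (lift (Y⊆Ac , Ac⊆Y) , isTop) i i∈ =
            ((λ i∈Ac → proj₁ (zero-at i) (proj₂ (Ac⊆Y i i∈ i∈Ac))) ,
             (λ fi≈0 → Y⊆Ac i i∈ (i∈ , proj₂ (zero-at i) fi≈0))) ,
            Sum.map (proj₁ (zero-at i)) (proj₁ (empty-at i)) (proj₂ (proj₁ top isTop i i∈))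
          backward : Encodes c (fs′ zero) → relI (GP A) (ζ-const c) fs′
          backward E =
            lift ((λ i i∈ (_ , z) → proj₂ (proj₁ (E i i∈)) (proj₁ (zero-at i) z)) ,
                  (λ i i∈ i∈Ac → i∈ , proj₂ (zero-at i) (proj₁ (proj₁ (E i i∈)) i∈Ac))) ,
            proj₂ top (λ i i∈ → i∈ , Sum.map (proj₂ (zero-at i)) (proj₂ (empty-at i)) (proj₂ (E i i∈)))

      encodes⇒g≈F : ∀ {c f} → Encodes c f → g A h f ≈F A c
      proj₁ (encodes⇒g≈F {c} {f} E) y∈ with proj₁ (∈-g⇔ f) y∈
      ... | j , j∈ , y∈hj with E j j∈
      ... | j∈Ac⇔ , inj₁ fj≈0 =
        subst (_∈ A c) (sym (singleton⁻ (proj₁ (h-zero j∈ fj≈0) y∈hj))) (proj₂ j∈Ac⇔ fj≈0)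
      ... | _ , inj₂ fj⊆[] = ⊥-elim (¬Any[] (fj⊆[] (proj₂ (proj₁ (h-nonEmpty⇔ j∈ (f j)) (_ , y∈hj)))))
      proj₂ (encodes⇒g≈F {c} {f} E) {y} y∈Ac =
        proj₂ (∈-g⇔ f) (y , y∈ , proj₂ (h-zero y∈ (proj₁ (proj₁ (E y y∈)) y∈Ac)) (here refl))
        where y∈ = inj₂ (c , y∈Ac)

      indicator : Fin n → I → FinSet
      indicator c i with em {i ∈ A c}
      ... | yes _ = [ 0I ]
      ... | no _ = []

      indicator-encodes : ∀ c → Encodes c (indicator c)
      indicator-encodes c i _ with em {i ∈ A c}
      ... | yes i∈Ac = ((λ _ → ≈F-refl) , (λ _ → i∈Ac)) , inj₁ ≈F-refl
      ... | no i∉Ac =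
        ((λ i∈Ac → ⊥-elim (i∉Ac i∈Ac)) , (λ []≈0 → ⊥-elim (¬Any[] (proj₂ []≈0 (here refl))))) , inj₂ (λ ())

      canonical : ∀ {k} → Term (MOsig n) k → (Fin k → I → FinSet) → I → FinSet
      canonical (var x) fs = fs x
      canonical (con c) fs = indicator c

      denotes-sound : ∀ {k} (t : Term (MOsig n) k) z (ρ : Fin k → I → FinSet) →
                      ⟦ GP A ⟧ (Denotes t z) ρ → g A h (ρ z) ≈F evalT (W A) (g A h ∘ ρ) t
      denotes-sound (var x) z ρ (lift (lift ρz≈ρx)) = proj₁ (g-≈F⇔ (ρ z) (ρ x)) ρz≈ρx
      denotes-sound (con c) z ρ (lift r) = encodes⇒g≈F (proj₁ (ζ-const-sem c (λ _ → ρ z)) r)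

      canonical-denotes : ∀ {k} (t : Term (MOsig n) k) fs d →
        ⟦ GP A ⟧ (Denotes (weaken₂ t) (suc zero)) (d ∷ᵥ canonical t fs ∷ᵥ fs) ×
        ⟦ GP A ⟧ (Denotes (weaken₂ t) zero) (canonical t fs ∷ᵥ d ∷ᵥ fs)
      canonical-denotes (var x) fs d = lift (lift (λ _ _ → ≈F-refl)) , lift (lift (λ _ _ → ≈F-refl))
      canonical-denotes (con c) fs d = lift (proj₂ (ζ-const-sem c (λ _ → indicator c)) (indicator-encodes c)) ,
                                       lift (proj₂ (ζ-const-sem c (λ _ → indicator c)) (indicator-encodes c))

      viaDenotations-sem : ∀ {k} (R : Fm (GPsig n) (suc (suc k))) (_∼_ : FinSet → FinSet → Set) →
        (∀ {B B′ C C′} → B ≈F B′ → C ≈F C′ → B ∼ C → B′ ∼ C′) →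
        ∀ fs → (∀ d₁ d₀ → ⟦ GP A ⟧ R (d₀ ∷ᵥ d₁ ∷ᵥ fs) ⇔ (g A h d₁ ∼ g A h d₀)) → ∀ s t →
        ⟦ GP A ⟧ (ViaDenotations R s t) fs ⇔ (evalT (W A) (g A h ∘ fs) s ∼ evalT (W A) (g A h ∘ fs) t)
      viaDenotations-sem R _∼_ ∼-resp fs R-sem s t = forward , backward
        where
          denoted : ∀ u z d₀ d₁ → ⟦ GP A ⟧ (Denotes (weaken₂ u) z) (d₀ ∷ᵥ d₁ ∷ᵥ fs) →
                    g A h ((d₀ ∷ᵥ d₁ ∷ᵥ fs) z) ≈F evalT (W A) (g A h ∘ fs) u
          denoted u z d₀ d₁ D = ≈F-trans (denotes-sound _ z _ D) (≈F-reflexive (evalT-renameT (W A) _ _ u))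
          forward : ⟦ GP A ⟧ (ViaDenotations R s t) fs → _
          forward (d₁ , d₀ , D₁ , D₀ , r) =
            ∼-resp (denoted s (suc zero) d₀ d₁ D₁) (denoted t zero d₀ d₁ D₀) (proj₁ (R-sem d₁ d₀) r)
          backward : _ → ⟦ GP A ⟧ (ViaDenotations R s t) fs
          backward s∼t = cs , ct , D₁ , D₀ ,
            proj₂ (R-sem cs ct)
              (∼-resp (≈F-sym (denoted s (suc zero) ct cs D₁)) (≈F-sym (denoted t zero ct cs D₀)) s∼t)
            where
              cs = canonical s fs
              ct = canonical t fs
              D₁ = proj₁ (canonical-denotes s fs ct)
              D₀ = proj₂ (canonical-denotes t fs cs)

      fromMO-sem : ∀ {k} {α : Fm (MOsig n) k} (atomic : IsAtomic α) (fs : Fin k → I → FinSet) →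
                   ⟦ GP A ⟧ (fromMO atomic) fs ⇔ ⟦ W A ⟧ α (g A h ∘ fs)
      fromMO-sem (rel-atomic ⊆R ts) fs = ⇔-Lift
        (viaDenotations-sem (rel₁₀ ζ-⊆) _⊆_ ⊆-resp-≈F fs
          (λ d₁ d₀ → Lift-⇔ (ζ-⊆-sem (d₁ ∷ᵥ d₀ ∷ᵥ []ᵥ))) (ts zero) (ts (suc zero)))
      fromMO-sem (rel-atomic ∃<R ts) fs = ⇔-Lift
        (viaDenotations-sem (rel₁₀ ζ-∃<) _∃<_ ∃<-resp-≈F fs
          (λ d₁ d₀ → Lift-⇔ (ζ-∃<-sem (d₁ ∷ᵥ d₀ ∷ᵥ []ᵥ))) (ts zero) (ts (suc zero)))
      fromMO-sem (eq-atomic s t) fs = ⇔-Lift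
        (viaDenotations-sem (var (suc zero) ≐ var zero) _≈F_ ≈F-resp-≈F fs
          (λ d₁ d₀ → Lift-⇔ (Lift-⇔ (g-≈F⇔ d₁ d₀))) s t)

proposition4p7 : ExcludedMiddle 0ℓ → ExcludedMiddle (lsuc 0ℓ) →
  (𝕀 : CountableDLO) → let open CountableDLO 𝕀 in let open Over 𝕀 in
  (n : ℕ) →
  (h : (Fin n → FinSet) → I → FinSet → FinSet) →
  (∀ A → IsoFamily A (h A)) →
    ((∀ {k} (α : Fm (MOsig n) k) → IsAtomic α →
        Σ (Fm (GPsig n) k) λ ψ →
          ∀ (A : Fin n → FinSet) (fs : Fin k → I → FinSet) →
            ⟦ GP A ⟧ ψ fs ⇔ ⟦ W A ⟧ α (g A (h A) ∘ fs))
    × (∀ {k} (ψ : Fm (GPsig n) k) → IsAtomic ψ →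
        Σ (Fm (MOsig n) k) λ φ →
          ∀ (A : Fin n → FinSet) (fs : Fin k → I → FinSet) →
            ⟦ GP A ⟧ ψ fs ⇔ ⟦ W A ⟧ φ (g A (h A) ∘ fs)))
-- Excluded middle is only needed for Set.
proposition4p7 em _ 𝕀 n h iso =
  (λ _ atomic → fromMO atomic , λ A fs → fromMO-sem 𝕀 A (h A) (iso A) em atomic fs) ,
  (λ _ atomic → fromGP atomic , λ A fs → fromGP-sem 𝕀 A (h A) (iso A) em atomic fs)
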